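{- Let $k\geq 2$ be an integer. For all integers $n\geq 3k$, $$ar(n, kC_{3})\geq\max\left\{\binom{3k-1}{2}+n-3k+1,\ \left\lfloor\frac{(n-k+2)^{2}}{4}\right\rfloor+(k-2)(n-k+2)+\binom{k-2}{2}+1\right\}.$$
   Context: An edge-coloring of a graph assigns a color to each edge; an edge-colored graph is rainbow if all colors on its edges are distinct. For a positive integer $n$ and a graph $F$, the anti-Ramsey number $ar(n,F)$ is the maximum number of colors in an edge-coloring of the complete graph $K_n$ containing no rainbow copy of $F$. $kC_3$ denotes the graph consisting of $k$ vertex-disjoint triangles. -}

module Defs where

open import Data.Nat as ℕ using (ℕ; _+_; _*_; _∸_; _≤_; _⊔_)
open import Data.Nat.Combinatorics using (_C_)
open import Data.Nat.DivMod using (_/_)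
open import Data.Fin as Fin using (Fin; zero; suc; _<?_)
open import Data.Fin.Patterns using (0F; 1F; 2F)
open import Data.List using (List; length; map; filter; concatMap; allFin; deduplicate)
open import Data.Product using (_×_; _,_; ∃; Σ)
open import Relation.Binary.PropositionalEquality using (_≡_)
open import Relation.Nullary using (¬_)

-- An edge-colouring of the complete graph K_n on vertex set Fin n:
-- a symmetric assignment of a colour (a natural number) to every pair of vertices.
-- (Values on the diagonal c i i are irrelevant: they are never used.)
record EdgeColouring (n : ℕ) : Set where
  field
    col  : Fin n → Fin n → ℕ
    symm : ∀ i j → col i j ≡ col j i
open EdgeColouring public

edgeColours : ∀ {n} → EdgeColouring n → List ℕ
edgeColours {n} c =
  concatMap (λ i → map (λ j → col c i j) (filter (λ j → i <? j) (allFin n))) (allFin n)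

numColours : ∀ {n} → EdgeColouring n → ℕ
numColours c = length (deduplicate ℕ._≟_ (edgeColours c))

triEdge : Fin 3 → Fin 3 × Fin 3
triEdge 0F = 0F , 1F
triEdge 1F = 1F , 2F
triEdge 2F = 0F , 2F

-- A copy of kC_3 in K_n: k vertex-disjoint triangles, given by an injective
-- vertex map v : (triangle index) → (corner) → vertex.
RainbowKC3 : ∀ {n} → EdgeColouring n → ℕ → Set
RainbowKC3 {n} c k =
  Σ (Fin k → Fin 3 → Fin n) λ v →
    (∀ t a s b → v t a ≡ v s b → (t ≡ s × a ≡ b)) ×
    (∀ t e s f →
       col c (v t (Data.Product.proj₁ (triEdge e))) (v t (Data.Product.proj₂ (triEdge e)))
       ≡ col c (v s (Data.Product.proj₁ (triEdge f))) (v s (Data.Product.proj₂ (triEdge f)))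
       → (t ≡ s × e ≡ f))

-- ar(n, kC_3) ≥ m : since ar(n,kC_3) is the maximum number of colours of an
-- edge-colouring of K_n with no rainbow kC_3, this holds iff some such
-- colouring uses at least m colours.
arKC3AtLeast : ℕ → ℕ → ℕ → Set
arKC3AtLeast n k m = ∃ λ (c : EdgeColouring n) → (m ≤ numColours c) × ¬ RainbowKC3 c k

bound : ℕ → ℕ → ℕ
bound n k =
  (((3 * k ∸ 1) C 2) + (n ∸ 3 * k) + 1)
  ⊔ (((n ∸ k + 2) * (n ∸ k + 2)) / 4 + (k ∸ 2) * (n ∸ k + 2) + ((k ∸ 2) C 2) + 1)

-- Two colourings of K_n without a rainbow kC₃.  In the first, the vertices 0,…,3k−2
-- span a rainbow clique and every other edge is coloured by its larger endpoint: a
-- triangle meeting a vertex outside the clique has two equal sides at its largest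
-- vertex, and k disjoint triangles inside the clique would need 3k vertices.  In the
-- second, m = n − k + 2 vertices carry a rainbow complete bipartite graph with balanced
-- parts and one extra colour on all edges inside the parts, while every edge meeting
-- the remaining k − 2 vertices gets its own colour: two of the k triangles avoid those
-- vertices, and each of them has a side inside a part.
module Submission where

open import Data.Empty using (⊥-elim)
open import Data.Fin as Fin using (Fin; toℕ; fromℕ<; punchIn; remQuot; combine)
open import Data.Fin.Patterns using (0F; 1F; 2F)
open import Data.Fin.Properties
  using (toℕ-injective; toℕ-fromℕ<; toℕ<n; injective⇒≤; any?; all?; ¬∀⟶∃¬;
         punchIn-injective; punchInᵢ≢i; combine-remQuot; toℕ-combine)
open import Data.List using (List; length; map; filter; allFin; deduplicate; lookup)
open import Data.List.Membership.Propositional using (_∈_)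
open import Data.List.Membership.Propositional.Properties
  using (∈-concatMap⁺; ∈-map⁺; ∈-filter⁺; ∈-allFin; ∈-deduplicate⁺)
open import Data.List.Relation.Unary.Any as Any using ()
open import Data.List.Relation.Unary.Any.Properties using (lookup-index)
open import Data.Nat
open import Data.Nat.Properties
open import Data.Nat.Combinatorics using (_C_; nC1≡n; nCk+nC[k+1]≡[n+1]C[k+1])
open import Data.Nat.Divisibility using (divides-refl)
open import Data.Nat.DivMod using (_/_; m*n/n≡m; +-distrib-/-∣ʳ)
open import Data.Nat.Tactic.RingSolver using (solve-∀)
open import Data.Product using (_×_; _,_; proj₁; proj₂; ∃; ∃₂; uncurry)
open import Data.Sum using (_⊎_; inj₁; inj₂)
open import Function using (_∘_)
open import Relation.Binary.PropositionalEquality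
open import Relation.Nullary using (¬_; yes; no)

open import Defs

open ≡-Reasoning

<-+-split : ∀ a {b c} → c < a + b → c < a ⊎ ∃ λ d → d < b × a + d ≡ c
<-+-split a {b} {c} c<a+b with c <? a
... | yes c<a = inj₁ c<a
... | no  c≮a = inj₂ (c ∸ a , +-cancelˡ-< a _ _ (subst (_< a + b) (sym a+d≡c) c<a+b) , a+d≡c)
  where
  a+d≡c : a + (c ∸ a) ≡ c
  a+d≡c = m+[n∸m]≡n (≮⇒≥ c≮a)

+-<-∸ : ∀ {a b d} → a ≤ b → d < b ∸ a → a + d < b
+-<-∸ {a} a≤b d<b∸a = subst (a + _ <_) (m+[n∸m]≡n a≤b) (+-monoʳ-< a d<b∸a)

injective-below⇒≤ : ∀ {m l} (g : Fin m → ℕ) → (∀ i → g i < l) →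
                    (∀ {i j} → g i ≡ g j → i ≡ j) → m ≤ l
injective-below⇒≤ g g<l g-injective =
  injective⇒≤ {f = λ i → fromℕ< (g<l i)} λ eq →
    g-injective (trans (sym (toℕ-fromℕ< _)) (trans (cong toℕ eq) (toℕ-fromℕ< _)))

argmax : ∀ {n} (w : Fin (suc n) → ℕ) → ∃ λ a → ∀ b → w b ≤ w a
argmax {zero}  w = 0F , λ { 0F → ≤-refl }
argmax {suc n} w with argmax (w ∘ Fin.suc)
... | a , max with ≤-total (w 0F) (w (Fin.suc a))
...   | inj₁ w0≤ = Fin.suc a , λ { Fin.zero → w0≤ ; (Fin.suc b) → max b }
...   | inj₂ ≤w0 = 0F , λ { Fin.zero → ≤-refl ; (Fin.suc b) → ≤-trans (max b) ≤w0 }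

quarter-square : ∀ m → m * m / 4 ≡ ⌊ m /2⌋ * ⌈ m /2⌉
quarter-square 0 = refl
quarter-square 1 = refl
quarter-square (suc (suc m)) = begin
  (2 + m) * (2 + m) / 4              ≡⟨ cong (_/ 4) (expand m) ⟩
  (m * m + (1 + m) * 4) / 4          ≡⟨ +-distrib-/-∣ʳ (m * m) (divides-refl (1 + m)) ⟩
  m * m / 4 + (1 + m) * 4 / 4        ≡⟨ cong₂ _+_ (quarter-square m) (m*n/n≡m (1 + m) 4) ⟩
  f * c + (1 + m)                    ≡⟨ cong (λ z → f * c + (1 + z)) (⌊n/2⌋+⌈n/2⌉≡n m) ⟨
  f * c + (1 + (f + c))              ≡⟨ factor f c ⟩
  (1 + f) * (1 + c)                  ∎
  where
  f c : ℕ
  f = ⌊ m /2⌋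
  c = ⌈ m /2⌉
  expand : ∀ m → (2 + m) * (2 + m) ≡ m * m + (1 + m) * 4
  expand = solve-∀
  factor : ∀ p q → p * q + (1 + (p + q)) ≡ (1 + p) * (1 + q)
  factor = solve-∀

triangular : ℕ → ℕ
triangular zero    = 0
triangular (suc n) = triangular n + n

triangular≡C2 : ∀ n → triangular n ≡ n C 2
triangular≡C2 zero    = refl
triangular≡C2 (suc n) = begin
  triangular n + n   ≡⟨ cong₂ _+_ (triangular≡C2 n) (sym (nC1≡n n)) ⟩
  n C 2 + n C 1      ≡⟨ +-comm (n C 2) (n C 1) ⟩
  n C 1 + n C 2      ≡⟨ nCk+nC[k+1]≡[n+1]C[k+1] n 1 ⟩
  suc n C 2          ∎

triangular-+ : ∀ m a → triangular (m + a) ≡ triangular m + (a * m + triangular a)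
triangular-+ m zero    = trans (cong triangular (+-identityʳ m)) (sym (+-identityʳ _))
triangular-+ m (suc a) = begin
  triangular (m + suc a)                          ≡⟨ cong triangular (+-suc m a) ⟩
  triangular (m + a) + (m + a)                    ≡⟨ cong (_+ (m + a)) (triangular-+ m a) ⟩
  triangular m + (a * m + triangular a) + (m + a) ≡⟨ regroup (triangular m) (triangular a) m a ⟩
  triangular m + (m + a * m + (triangular a + a)) ∎
  where
  regroup : ∀ s t m a → s + (a * m + t) + (m + a) ≡ s + (m + a * m + (t + a))
  regroup = solve-∀

triangular-mono-≤ : ∀ {m n} → m ≤ n → triangular m ≤ triangular n
triangular-mono-≤ {m} m≤n with m≤n⇒∃[o]m+o≡n m≤n
... | o , refl = subst (triangular m ≤_) (sym (triangular-+ m o)) (m≤m+n (triangular m) _)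

triangular-code-≥⇒≤ : ∀ {m x y} → x < y → triangular m ≤ triangular y + x → m ≤ y
triangular-code-≥⇒≤ {m} {x} {y} x<y Tm≤ = ≮⇒≥ λ y<m →
  <⇒≱ (<-≤-trans (+-monoʳ-< (triangular y) x<y) (triangular-mono-≤ y<m)) Tm≤

Realised : ℕ → (ℕ → ℕ → ℕ) → ℕ → Set
Realised n F c = ∃₂ λ x y → x < y × y < n × F x y ≡ c

triangular-pairing : ∀ n c → c < triangular n → Realised n (λ x y → triangular y + x) c
triangular-pairing (suc n) c c<T with <-+-split (triangular n) c<T
... | inj₁ c<Tn = let x , y , x<y , y<n , eq = triangular-pairing n c c<Tn
                  in x , y , x<y , m<n⇒m<1+n y<n , eq
... | inj₂ (d , d<n , eq) = d , n , d<n , ≤-refl , eq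

pairColour : (ℕ → ℕ → ℕ) → ℕ → ℕ → ℕ
pairColour F x y = F (x ⊓ y) (x ⊔ y)

pairColour-comm : ∀ F x y → pairColour F x y ≡ pairColour F y x
pairColour-comm F x y = cong₂ F (⊓-comm x y) (⊔-comm x y)

pairColour-< : ∀ F {x y} → x < y → pairColour F x y ≡ F x y
pairColour-< F x<y = cong₂ F (m≤n⇒m⊓n≡m (<⇒≤ x<y)) (m≤n⇒m⊔n≡n (<⇒≤ x<y))

pairColouring : ∀ n → (ℕ → ℕ → ℕ) → EdgeColouring n
pairColouring n F = record
  { col  = λ i j → pairColour F (toℕ i) (toℕ j)
  ; symm = λ i j → pairColour-comm F (toℕ i) (toℕ j)
  }

realised∈edgeColours : ∀ {n F c} → Realised n F c → c ∈ edgeColours (pairColouring n F)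
realised∈edgeColours {n} {F} (x , y , x<y , y<n , refl) =
  ∈-concatMap⁺ _ (Any.map (λ { refl → inRow }) (∈-allFin i))
  where
  i j : Fin n
  i = fromℕ< (<-trans x<y y<n)
  j = fromℕ< y<n
  i<j : i Fin.< j
  i<j = subst₂ _<_ (sym (toℕ-fromℕ< _)) (sym (toℕ-fromℕ< _)) x<y
  colour : col (pairColouring n F) i j ≡ F x y
  colour = trans (pairColour-< F i<j) (cong₂ F (toℕ-fromℕ< _) (toℕ-fromℕ< _))
  row : List ℕ
  row = map (col (pairColouring n F) i) (filter (i Fin.<?_) (allFin n))
  inRow : F x y ∈ row
  inRow = subst (_∈ row) colour (∈-map⁺ _ (∈-filter⁺ (i Fin.<?_) (∈-allFin j) i<j))

≤-length-deduplicate : ∀ m (xs : List ℕ) → (∀ c → c < m → c ∈ xs) → m ≤ length (deduplicate _≟_ xs)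
≤-length-deduplicate m xs below∈xs = injective⇒≤ {f = position} position-injective
  where
  ys : List ℕ
  ys = deduplicate _≟_ xs
  ∈ys : (i : Fin m) → toℕ i ∈ ys
  ∈ys i = ∈-deduplicate⁺ _≟_ (below∈xs (toℕ i) (toℕ<n i))
  position : Fin m → Fin (length ys)
  position i = Any.index (∈ys i)
  position-injective : ∀ {i j} → position i ≡ position j → i ≡ j
  position-injective {i} {j} eq = toℕ-injective (begin
    toℕ i                ≡⟨ lookup-index (∈ys i) ⟩
    lookup ys (position i) ≡⟨ cong (lookup ys) eq ⟩
    lookup ys (position j) ≡⟨ lookup-index (∈ys j) ⟨
    toℕ j                ∎)

numColours-≥ : ∀ {n F} m → (∀ c → c < m → Realised n F c) → m ≤ numColours (pairColouring n F)
numColours-≥ m realised = ≤-length-deduplicate m _ λ c c<m → realised∈edgeColours (realised c c<m)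

VertexDisjoint : ∀ {k n} → (Fin k → Fin 3 → Fin n) → Set
VertexDisjoint v = ∀ t a s b → v t a ≡ v s b → t ≡ s × a ≡ b

VertexDisjoint-punchIn : ∀ {k n} {v : Fin (suc k) → Fin 3 → Fin n} →
                         VertexDisjoint v → ∀ t → VertexDisjoint (v ∘ punchIn t)
VertexDisjoint-punchIn disjoint t s a s′ b eq =
  let s≡s′ , a≡b = disjoint _ a _ b eq in punchIn-injective t s s′ s≡s′ , a≡b

side : ∀ {n} → EdgeColouring n → (Fin 3 → Fin n) → Fin 3 → ℕ
side c w e = col c (w (proj₁ (triEdge e))) (w (proj₂ (triEdge e)))

RepeatsColour : ∀ {n} → EdgeColouring n → (Fin 3 → Fin n) → Set
RepeatsColour c w = ∃₂ λ e f → e ≢ f × side c w e ≡ side c w f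

rainbow⇒¬RepeatsColour : ∀ {n k} {c : EdgeColouring n} (R : RainbowKC3 c k) t →
                         ¬ RepeatsColour c (proj₁ R t)
rainbow⇒¬RepeatsColour (_ , _ , rainbow) t (e , f , e≢f , same) = e≢f (proj₂ (rainbow t e t f same))

∃-vertex-≥ : ∀ {k n l} (v : Fin k → Fin 3 → Fin n) → VertexDisjoint v → l < 3 * k →
             ∃₂ λ t a → l ≤ toℕ (v t a)
∃-vertex-≥ {k} {l = l} v disjoint l<3k with any? (λ t → any? (λ a → l ≤? toℕ (v t a)))
... | yes found = found
... | no  none  =
  ⊥-elim (<⇒≱ l<3k (subst (_≤ l) (*-comm k 3) (injective-below⇒≤ vertex below injective)))
  where
  vertex : Fin (k * 3) → ℕ
  vertex i = toℕ (uncurry v (remQuot {k} 3 i))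
  below : ∀ i → vertex i < l
  below i = ≰⇒> λ l≤ → none (_ , _ , l≤)
  injective : ∀ {i j} → vertex i ≡ vertex j → i ≡ j
  injective {i} {j} eq with disjoint _ _ _ _ (toℕ-injective eq)
  ... | t≡s , a≡b = begin
    i                                  ≡⟨ combine-remQuot {k} 3 i ⟨
    uncurry combine (remQuot {k} 3 i)  ≡⟨ cong₂ combine t≡s a≡b ⟩
    uncurry combine (remQuot {k} 3 j)  ≡⟨ combine-remQuot {k} 3 j ⟩
    j                                  ∎

module _ (F : ℕ → ℕ → ℕ) (H : ℕ → ℕ) {l} (colour-high : ∀ x y → l ≤ y → F x y ≡ H y) where

  sides-at-apex : ∀ {p q r} → l ≤ p → q ≤ p → r ≤ p → pairColour F p q ≡ pairColour F p r
  sides-at-apex {p} l≤p q≤p r≤p = trans (toApex q≤p) (sym (toApex r≤p))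
    where
    toApex : ∀ {q} → q ≤ p → pairColour F p q ≡ H p
    toApex q≤p = trans (cong (F _) (m≥n⇒m⊔n≡m q≤p)) (colour-high _ p l≤p)

  repeatsColour-at-high-vertex : ∀ {n} (w : Fin 3 → Fin n) a → l ≤ toℕ (w a) →
                                 RepeatsColour (pairColouring n F) w
  repeatsColour-at-high-vertex w a l≤ with argmax (toℕ ∘ w)
  ... | 0F , max = 0F , 2F , (λ ()) , sides-at-apex (≤-trans l≤ (max a)) (max 1F) (max 2F)
  ... | 1F , max = 0F , 1F , (λ ()) ,
    trans (pairColour-comm F _ _) (sides-at-apex (≤-trans l≤ (max a)) (max 0F) (max 2F))
  ... | 2F , max = 1F , 2F , (λ ()) ,
    trans (pairColour-comm F _ _)
          (trans (sides-at-apex (≤-trans l≤ (max a)) (max 1F) (max 0F)) (pairColour-comm F _ _))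

cliqueColour : ℕ → ℕ → ℕ → ℕ
cliqueColour l x y with l ≤? y
... | yes _ = triangular l + (y ∸ l)
... | no  _ = triangular y + x

cliqueColour-high : ∀ l x y → l ≤ y → cliqueColour l x y ≡ triangular l + (y ∸ l)
cliqueColour-high l x y l≤y with l ≤? y
... | yes _   = refl
... | no  l≰y = ⊥-elim (l≰y l≤y)

cliqueColour-low : ∀ l x y → y < l → cliqueColour l x y ≡ triangular y + x
cliqueColour-low l x y y<l with l ≤? y
... | yes l≤y = ⊥-elim (<⇒≱ y<l l≤y)
... | no  _   = refl

cliqueColouring-numColours : ∀ {n} l → 1 ≤ l → l ≤ n →
                             triangular l + (n ∸ l) ≤ numColours (pairColouring n (cliqueColour l))
cliqueColouring-numColours {n} l 1≤l l≤n = numColours-≥ _ realise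
  where
  realise : ∀ c → c < triangular l + (n ∸ l) → Realised n (cliqueColour l) c
  realise c c< with <-+-split (triangular l) c<
  ... | inj₁ c<T = let x , y , x<y , y<l , eq = triangular-pairing l c c<T
                   in x , y , x<y , <-≤-trans y<l l≤n , trans (cliqueColour-low l x y y<l) eq
  ... | inj₂ (d , d<n∸l , eq) =
    0 , l + d , <-≤-trans 1≤l (m≤m+n l d) , +-<-∸ l≤n d<n∸l ,
    trans (cliqueColour-high l 0 (l + d) (m≤m+n l d))
          (trans (cong (triangular l +_) (m+n∸m≡n l d)) eq)

cliqueColouring-noRainbowKC3 : ∀ {n k} l → l < 3 * k →
                               ¬ RainbowKC3 (pairColouring n (cliqueColour l)) k
cliqueColouring-noRainbowKC3 {n} l l<3k R@(v , disjoint , _) =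
  let t , a , l≤ = ∃-vertex-≥ v disjoint l<3k
  in rainbow⇒¬RepeatsColour {c = pairColouring n (cliqueColour l)} R t
       (repeatsColour-at-high-vertex (cliqueColour l) (λ y → triangular l + (y ∸ l))
                                     (cliqueColour-high l) (v t) a l≤)

-- Parts [0, p) and [p, p + q); the vertices from p + q on are the k − 2 extra ones.
bipartiteColour : ℕ → ℕ → ℕ → ℕ → ℕ
bipartiteColour p q x y with p + q ≤? y
... | yes _ = suc (p * q + (triangular y + x ∸ triangular (p + q)))
... | no  _ with x <? p | p ≤? y
...   | yes _ | yes _ = suc (q * x + (y ∸ p))
...   | _     | _     = 0

bipartiteColour-high :
  ∀ p q x y → p + q ≤ y →
  bipartiteColour p q x y ≡ suc (p * q + (triangular y + x ∸ triangular (p + q)))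
bipartiteColour-high p q x y m≤y with p + q ≤? y
... | yes _   = refl
... | no  m≰y = ⊥-elim (m≰y m≤y)

bipartiteColour-cross : ∀ p q x y → y < p + q → x < p → p ≤ y →
                        bipartiteColour p q x y ≡ suc (q * x + (y ∸ p))
bipartiteColour-cross p q x y y<m x<p p≤y with p + q ≤? y
... | yes m≤y = ⊥-elim (<⇒≱ y<m m≤y)
... | no  _ with x <? p | p ≤? y
...   | yes _ | yes _   = refl
...   | no x≮p | _      = ⊥-elim (x≮p x<p)
...   | yes _ | no p≰y  = ⊥-elim (p≰y p≤y)

bipartiteColour-inside : ∀ p q x y → y < p + q → p ≤ x ⊎ y < p → bipartiteColour p q x y ≡ 0
bipartiteColour-inside p q x y y<m inside with p + q ≤? y
... | yes m≤y = ⊥-elim (<⇒≱ y<m m≤y)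
... | no  _ with x <? p | p ≤? y | inside
...   | yes x<p | yes _   | inj₁ p≤x = ⊥-elim (<⇒≱ x<p p≤x)
...   | yes _   | yes p≤y | inj₂ y<p = ⊥-elim (<⇒≱ y<p p≤y)
...   | yes _   | no  _   | _        = refl
...   | no  _   | _       | _        = refl

module _ {n p q} (w : Fin 3 → Fin n) (below : ∀ a → toℕ (w a) < p + q) where

  private
    samePart : ∀ a b → (toℕ (w a) < p × toℕ (w b) < p) ⊎ (p ≤ toℕ (w a) × p ≤ toℕ (w b)) →
               pairColour (bipartiteColour p q) (toℕ (w a)) (toℕ (w b)) ≡ 0
    samePart a b (inj₁ (x<p , y<p)) =
      bipartiteColour-inside p q _ _ (⊔-pres-<m (below a) (below b)) (inj₂ (⊔-pres-<m x<p y<p))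
    samePart a b (inj₂ (p≤x , p≤y)) =
      bipartiteColour-inside p q _ _ (⊔-pres-<m (below a) (below b)) (inj₁ (⊓-glb p≤x p≤y))

  bipartite-zeroSide : ∃ λ e → side (pairColouring n (bipartiteColour p q)) w e ≡ 0
  bipartite-zeroSide with toℕ (w 0F) <? p | toℕ (w 1F) <? p | toℕ (w 2F) <? p
  ... | yes x | yes y | _     = 0F , samePart 0F 1F (inj₁ (x , y))
  ... | no  x | no  y | _     = 0F , samePart 0F 1F (inj₂ (≮⇒≥ x , ≮⇒≥ y))
  ... | _     | yes y | yes z = 1F , samePart 1F 2F (inj₁ (y , z))
  ... | _     | no  y | no  z = 1F , samePart 1F 2F (inj₂ (≮⇒≥ y , ≮⇒≥ z))
  ... | yes x | no  _ | yes z = 2F , samePart 0F 2F (inj₁ (x , z))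
  ... | no  x | yes _ | no  z = 2F , samePart 0F 2F (inj₂ (≮⇒≥ x , ≮⇒≥ z))

∃-triangle-below : ∀ {a m} (v : Fin (suc a) → Fin 3 → Fin (m + a)) → VertexDisjoint v →
                   ∃ λ t → ∀ b → toℕ (v t b) < m
∃-triangle-below {a} {m} v disjoint with any? (λ t → all? (λ b → toℕ (v t b) <? m))
... | yes found = found
... | no  none  = ⊥-elim (1+n≰n (injective-below⇒≤ excess excess<a injective))
  where
  highCorner : ∀ t → ∃ λ b → m ≤ toℕ (v t b)
  highCorner t =
    let b , b≮m = ¬∀⟶∃¬ 3 _ (λ b → toℕ (v t b) <? m) (λ below → none (t , below)) in b , ≮⇒≥ b≮m
  high : Fin (suc a) → Fin (m + a)
  high t = v t (proj₁ (highCorner t))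
  excess : Fin (suc a) → ℕ
  excess t = toℕ (high t) ∸ m
  excess<a : ∀ t → excess t < a
  excess<a t = subst (excess t <_) (m+n∸m≡n m a) (∸-monoˡ-< (toℕ<n (high t)) (proj₂ (highCorner t)))
  injective : ∀ {t s} → excess t ≡ excess s → t ≡ s
  injective {t} {s} eq = proj₁ (disjoint _ _ _ _ (toℕ-injective
    (∸-cancelʳ-≡ (proj₂ (highCorner t)) (proj₂ (highCorner s)) eq)))

bipartiteColouring-noRainbowKC3 : ∀ p q {a} →
                                  ¬ RainbowKC3 (pairColouring (p + q + a) (bipartiteColour p q)) (2 + a)
bipartiteColouring-noRainbowKC3 p q (v , disjoint , rainbow) =
  let s₁ , below₁ = triangleBelow 0F
      t₁          = punchIn 0F s₁
      s₂ , below₂ = triangleBelow t₁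
      e₁ , zero₁  = bipartite-zeroSide {p = p} {q} (v t₁) below₁
      e₂ , zero₂  = bipartite-zeroSide {p = p} {q} (v (punchIn t₁ s₂)) below₂
  in punchInᵢ≢i t₁ s₂ (sym (proj₁ (rainbow t₁ e₁ _ e₂ (trans zero₁ (sym zero₂)))))
  where
  triangleBelow : ∀ t → ∃ λ s → ∀ b → toℕ (v (punchIn t s) b) < p + q
  triangleBelow t = ∃-triangle-below (v ∘ punchIn t) (VertexDisjoint-punchIn disjoint t)

bipartiteColouring-numColours :
  ∀ p q {a} → 2 ≤ p →
  suc (p * q + (a * (p + q) + triangular a))
    ≤ numColours (pairColouring (p + q + a) (bipartiteColour p q))
bipartiteColouring-numColours p q {a} 2≤p = numColours-≥ _ realise
  where
  m n : ℕ
  m = p + q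
  n = m + a
  p≤n : p ≤ n
  p≤n = ≤-trans (m≤m+n p q) (m≤m+n m a)

  cross : ∀ {c} → c < p * q → Realised n (bipartiteColour p q) (suc c)
  cross {c} c<pq with remQuot {p} q (fromℕ< c<pq) in split
  ... | i , j = toℕ i , p + toℕ j , <-≤-trans (toℕ<n i) (m≤m+n p _) , <-≤-trans y<m (m≤m+n m a) ,
                trans (bipartiteColour-cross p q _ _ y<m (toℕ<n i) (m≤m+n p _)) (cong suc colour)
    where
    y<m : p + toℕ j < m
    y<m = +-monoʳ-< p (toℕ<n j)
    colour : q * toℕ i + (p + toℕ j ∸ p) ≡ c
    colour = begin
      q * toℕ i + (p + toℕ j ∸ p)  ≡⟨ cong (q * toℕ i +_) (m+n∸m≡n p (toℕ j)) ⟩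
      q * toℕ i + toℕ j            ≡⟨ toℕ-combine i j ⟨
      toℕ (combine i j)            ≡⟨ cong (toℕ ∘ uncurry combine) split ⟨
      toℕ (uncurry combine (remQuot {p} q (fromℕ< c<pq)))
                                   ≡⟨ cong toℕ (combine-remQuot {p} q (fromℕ< c<pq)) ⟩
      toℕ (fromℕ< c<pq)            ≡⟨ toℕ-fromℕ< c<pq ⟩
      c                            ∎

  high : ∀ {d} → d < a * m + triangular a → Realised n (bipartiteColour p q) (suc (p * q + d))
  high {d} d< =
    let x , y , x<y , y<n , code = triangular-pairing n (triangular m + d) Tm+d<Tn
        m≤y = triangular-code-≥⇒≤ x<y (subst (triangular m ≤_) (sym code) (m≤m+n (triangular m) d))
    in x , y , x<y , y<n ,
       trans (bipartiteColour-high p q x y m≤y)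
             (cong (λ e → suc (p * q + e))
                   (trans (cong (_∸ triangular m) code) (m+n∸m≡n (triangular m) d)))
    where
    Tm+d<Tn : triangular m + d < triangular n
    Tm+d<Tn = subst (triangular m + d <_) (sym (triangular-+ m a)) (+-monoʳ-< (triangular m) d<)

  realise : ∀ c → c < suc (p * q + (a * m + triangular a)) → Realised n (bipartiteColour p q) c
  realise zero    _        = 0 , 1 , z<s , ≤-trans 2≤p p≤n ,
                             bipartiteColour-inside p q 0 1 (≤-trans 2≤p (m≤m+n p q)) (inj₂ 2≤p)
  realise (suc c) (s≤s c<) with <-+-split (p * q) c<
  ... | inj₁ c<pq          = cross c<pq
  ... | inj₂ (d , d< , refl) = high d<

clique-lowerBound : ∀ {n k} l → 1 ≤ l → l ≤ n → l < 3 * k →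
                    arKC3AtLeast n k (triangular l + (n ∸ l))
clique-lowerBound l 1≤l l≤n l<3k =
  pairColouring _ (cliqueColour l) ,
  cliqueColouring-numColours l 1≤l l≤n ,
  cliqueColouring-noRainbowKC3 l l<3k

bipartite-lowerBound : ∀ {p q a} → 2 ≤ p →
                       arKC3AtLeast (p + q + a) (2 + a) (p * q + a * (p + q) + a C 2 + 1)
bipartite-lowerBound {p} {q} {a} 2≤p =
  colouring ,
  subst (_≤ numColours colouring) count (bipartiteColouring-numColours p q 2≤p) ,
  bipartiteColouring-noRainbowKC3 p q
  where
  colouring : EdgeColouring (p + q + a)
  colouring = pairColouring (p + q + a) (bipartiteColour p q)
  regroup : ∀ x y z → suc (x + (y + z)) ≡ x + y + z + 1
  regroup = solve-∀
  count : suc (p * q + (a * (p + q) + triangular a)) ≡ p * q + a * (p + q) + a C 2 + 1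
  count = trans (regroup (p * q) (a * (p + q)) (triangular a))
                (cong (λ t → p * q + a * (p + q) + t + 1) (triangular≡C2 a))

arKC3AtLeast-⊔ : ∀ {n k b₁ b₂} → arKC3AtLeast n k b₁ → arKC3AtLeast n k b₂ →
                 arKC3AtLeast n k (b₁ ⊔ b₂)
arKC3AtLeast-⊔ {b₁ = b₁} {b₂} A₁ A₂ with ⊔-sel b₁ b₂
... | inj₁ eq = subst (arKC3AtLeast _ _) (sym eq) A₁
... | inj₂ eq = subst (arKC3AtLeast _ _) (sym eq) A₂

theorem1p1 : ∀ (k n : ℕ) → 2 ≤ k → 3 * k ≤ n → arKC3AtLeast n k (bound n k)
theorem1p1 k@(suc (suc a)) n (s≤s (s≤s z≤n)) 3k≤n = arKC3AtLeast-⊔ clique bipartite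
  where
  l : ℕ
  l = 3 * k ∸ 1
  clique : arKC3AtLeast n k (l C 2 + (n ∸ 3 * k) + 1)
  clique = subst (arKC3AtLeast n k) count (clique-lowerBound l z<s (≤-trans (n≤1+n l) 3k≤n) ≤-refl)
    where
    n∸l : n ∸ l ≡ n ∸ 3 * k + 1
    n∸l = trans (cong (_∸ 3 * k) (+-comm 1 n)) (+-∸-comm 1 3k≤n)
    count : triangular l + (n ∸ l) ≡ l C 2 + (n ∸ 3 * k) + 1
    count = trans (cong₂ _+_ (triangular≡C2 l) n∸l) (sym (+-assoc (l C 2) _ 1))

  m : ℕ
  m = n ∸ k + 2
  bipartite : arKC3AtLeast n k (m * m / 4 + a * m + a C 2 + 1)
  bipartite = subst₂ (λ n′ c → arKC3AtLeast n′ k (c + a * m + a C 2 + 1))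
                     m+a≡n (sym (quarter-square m))
                (subst (λ m′ → arKC3AtLeast (m′ + a) k (⌊ m /2⌋ * ⌈ m /2⌉ + a * m′ + a C 2 + 1))
                       (⌊n/2⌋+⌈n/2⌉≡n m) (bipartite-lowerBound 2≤⌊m/2⌋))
    where
    m+a≡n : m + a ≡ n
    m+a≡n = trans (+-assoc (n ∸ k) 2 a) (m∸n+n≡m (≤-trans (m≤m+n k _) 3k≤n))
    2≤n∸k : 2 ≤ n ∸ k
    2≤n∸k = ≤-trans (s≤s (s≤s z≤n)) (subst (_≤ n ∸ k) (m+n∸m≡n k (k + (k + 0))) (∸-monoˡ-≤ k 3k≤n))
    2≤⌊m/2⌋ : 2 ≤ ⌊ m /2⌋
    2≤⌊m/2⌋ = ⌊n/2⌋-mono (+-monoˡ-≤ 2 2≤n∸k)
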